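{- Let $X\subseteq\omega$ be an infinite set with uniqueness of sums and let $u\in\beta\omega$ be an $X$-adequate ultrafilter. Then $u$ generates a free subsemigroup, i.e. for all $n,m\in\mathbb N$, $u^n=u^m$ iff $n=m$.
   Context: $\mathrm{FS}(A)$ is the set of sums of finite nonempty subsets of $A$. $A\subseteq\omega$ has uniqueness of sums if whenever $a_1<\dots<a_n$, $b_1<\dots<b_m$ in $A$ have equal sums, $n=m$ and $a_i=b_i$. For infinite $X$ with increasing enumeration $\langle x_n\rangle$, $A$ is $X$-adequate if $A\subseteq\mathrm{FS}(X)$ and for every subsequence $\langle x_{n_k}:k\ge1\rangle$ there is a unique $m\ge1$ with $x_{n_1}+\dots+x_{n_m}\in A$; an ultrafilter $u$ is $X$-adequate if some $X$-adequate set is in $u$ and $\mathrm{FS}(Y)\in u$ for every cofinite $Y\subseteq X$. $u+v=\{B : \{x : \{y : x+y\in B\}\in v\}\in u\}$ and $u^n=u+\cdots+u$ ($n$ times). -}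

module Defs where

open import Level using (0ℓ)
open import Data.Nat using (ℕ; zero; suc; _+_; _<_; _≤_)
open import Data.List using (List; []; _∷_)
open import Data.Nat.ListAction using (sum)
open import Data.List.Relation.Unary.All using (All)
open import Data.List.Relation.Unary.Linked using (Linked)
open import Data.Product using (Σ; _×_; ∃)
open import Data.Sum using (_⊎_)
open import Data.Empty using (⊥)
open import Data.Unit using () renaming (⊤ to ⊤′)
open import Relation.Nullary using (¬_)
open import Relation.Unary using (Pred; _⊆_; ∁; _∩_; Empty)
open import Relation.Binary.PropositionalEquality using (_≡_)

Subset : Set₁
Subset = Pred ℕ 0ℓ

record FinSub (A : Subset) : Set where
  constructor finSub
  field
    elems    : List ℕ
    nonempty : ¬ (elems ≡ [])
    strict   : Linked _<_ elems
    inA      : All A elems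

FS : Subset → Subset
FS A x = Σ (FinSub A) (λ F → sum (FinSub.elems F) ≡ x)

UniqueSums : Subset → Set
UniqueSums A = (F G : FinSub A) → sum (FinSub.elems F) ≡ sum (FinSub.elems G) →
               FinSub.elems F ≡ FinSub.elems G

StrictlyIncreasing : (ℕ → ℕ) → Set
StrictlyIncreasing f = ∀ i → f i < f (suc i)

Range : (ℕ → ℕ) → Subset
Range x y = ∃ λ n → x n ≡ y

partialSum : (ℕ → ℕ) → ℕ → ℕ
partialSum f zero    = 0
partialSum f (suc m) = partialSum f m + f m

-- X-adequate set, X given by its increasing enumeration x (x 0 < x 1 < …).
-- A subsequence ⟨x_{n_k}⟩ is given by a strictly increasing index map ν;
-- partialSum (x ∘ ν) m = x_{ν 0} + … + x_{ν (m-1)} (sum of first m terms).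
Adequate : (ℕ → ℕ) → Subset → Set
Adequate x A =
  (A ⊆ FS (Range x)) ×
  ((ν : ℕ → ℕ) → StrictlyIncreasing ν →
     Σ ℕ λ m → (1 ≤ m) × A (partialSum (λ k → x (ν k)) m) ×
       (∀ m' → 1 ≤ m' → A (partialSum (λ k → x (ν k)) m') → m' ≡ m))

-- Y ⊆ X cofinite in X (X = Range x): X ∖ Y is finite, i.e. bounded
CofiniteIn : (ℕ → ℕ) → Subset → Set
CofiniteIn x Y = (Y ⊆ Range x) × (∃ λ N → ∀ k → N ≤ x k → Y (x k))

record Ultrafilter : Set₁ where
  field
    mem     : Subset → Set
    full    : mem (λ _ → ⊤′)
    noEmpty : ∀ A → Empty A → ¬ mem A
    upward  : ∀ {A B} → A ⊆ B → mem A → mem B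
    inter   : ∀ {A B} → mem A → mem B → mem (A ∩ B)
    ultra   : ∀ A → mem A ⊎ mem (∁ A)

AdequateUF : (ℕ → ℕ) → Ultrafilter → Set₁
AdequateUF x u =
  (Σ Subset λ A → Adequate x A × Ultrafilter.mem u A) ×
  (∀ Y → CofiniteIn x Y → Ultrafilter.mem u (FS Y))

_⊕_ : (Subset → Set) → (Subset → Set) → Subset → Set
(U ⊕ V) B = U (λ x → V (λ y → B (x + y)))

-- membership predicate of uⁿ: u⁰ = principal at 0, uⁿ⁺¹ = uⁿ + u (so u¹ = u)
pow : Ultrafilter → ℕ → Subset → Set
pow u zero    B = B 0
pow u (suc n) B = (pow u n ⊕ Ultrafilter.mem u) B

_≈U_ : (Subset → Set) → (Subset → Set) → Set₁
U ≈U V = ∀ B → (U B → V B) × (V B → U B)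

{-# OPTIONS --safe #-}
module Submission where

open import Defs
open import Data.Nat using (ℕ; _≤_)
open import Data.Product using (_×_)
open import Relation.Binary.PropositionalEquality using (_≡_)

open import Data.Nat using (zero; suc; _+_; _<_; _≤′_; ≤′-refl; ≤′-step; z≤n; s≤s; _≟_)
open import Data.Nat.Properties
  using (≤-refl; ≤-trans; <⇒≤; <⇒≱; ≰⇒>; ≤-<-trans; <-trans; m≤m+n; m≤n+m; +-monoʳ-<; n<1+n;
         +-assoc; +-comm; suc-injective; ≤⇒≤′)
open import Data.List using (List; []; _∷_; _++_; map; length)
open import Data.List.Properties using (∷-injective; ∷-injectiveˡ; ∷-injectiveʳ; ++-identityʳ; ++-assoc)
open import Data.Nat.ListAction using (sum)
open import Data.Nat.ListAction.Properties using (sum-++)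
open import Data.List.Relation.Unary.All as All using (All; []; _∷_)
open import Data.List.Relation.Unary.All.Properties using (++⁺; ++⁻ʳ)
open import Data.List.Relation.Unary.AllPairs.Properties as AllPairs using ()
open import Data.List.Relation.Unary.Linked as Linked using (Linked; []; _∷_)
open import Data.List.Relation.Unary.Linked.Properties using (Linked⇒AllPairs; AllPairs⇒Linked; map⁻)
open import Data.Product using (Σ; _,_; proj₁; proj₂)
open import Data.Empty using (⊥-elim)
open import Function using (_∘_; id)
open import Relation.Nullary using (¬_)
open import Relation.Nullary.Decidable using (decidable-stable)
open import Relation.Unary using (_⊆_; _∩_; Empty)
open import Relation.Binary.PropositionalEquality using (_≢_; refl; sym; trans; cong; cong₂; subst; module ≡-Reasoning)

open FinSub
open Ultrafilter using (mem)

-- Let A ∈ u be X-adequate.  Call z a k-block sum if z = ΣF for a finite F ⊆ X whose increasing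
-- enumeration splits into k consecutive nonempty blocks, each summing into A.  The k-block sums
-- form a member of uᵏ: appending to F a block from A ∩ FS(X ∩ (ΣF, ∞)) ∈ u adds one block.
-- Conversely z determines F by uniqueness of sums, and adequacy, applied to any infinite
-- increasing extension of F, determines the length of the first block; so z determines k.
-- Hence uⁿ and uᵐ contain disjoint sets when n ≠ m.

++-≢[] : ∀ {P R : List ℕ} → P ≢ [] → P ++ R ≢ []
++-≢[] {[]}    P≢[] _ = P≢[] refl
++-≢[] {_ ∷ _} _    ()

++-cancel-length : ∀ (P R P′ R′ : List ℕ) → P ++ R ≡ P′ ++ R′ → length P ≡ length P′ →
                   P ≡ P′ × R ≡ R′
++-cancel-length []      R []        R′ e _  = refl , e
++-cancel-length (p ∷ P) R (p′ ∷ P′) R′ e |P|≡|P′|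
  with ∷-injective e
... | refl , e′ with ++-cancel-length P R P′ R′ e′ (suc-injective |P|≡|P′|)
...   | refl , R≡R′ = refl , R≡R′

length-≢[] : ∀ {P : List ℕ} → P ≢ [] → 1 ≤ length P
length-≢[] {[]}    P≢[] = ⊥-elim (P≢[] refl)
length-≢[] {_ ∷ _} _    = s≤s z≤n

Linked-++⁻ʳ : ∀ (P : List ℕ) {Q} → Linked _<_ (P ++ Q) → Linked _<_ Q
Linked-++⁻ʳ []      l = l
Linked-++⁻ʳ (_ ∷ P) l = Linked-++⁻ʳ P (Linked.tail l)

All-≤-sum : ∀ L → All (_≤ sum L) L
All-≤-sum []      = []
All-≤-sum (l ∷ L) = m≤m+n l (sum L) ∷ All.map (λ l′≤ΣL → ≤-trans l′≤ΣL (m≤n+m (sum L) l)) (All-≤-sum L)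

partialSum-suc : ∀ (f : ℕ → ℕ) m → partialSum f (suc m) ≡ f 0 + partialSum (f ∘ suc) m
partialSum-suc f zero    = +-comm 0 (f 0)
partialSum-suc f (suc m) = trans (cong (_+ f (suc m)) (partialSum-suc f m)) (+-assoc (f 0) _ _)

FinSub-map : ∀ {A B : Subset} → A ⊆ B → FinSub A → FinSub B
FinSub-map A⊆B F = finSub (elems F) (nonempty F) (strict F) (All.map A⊆B (inA F))

FinSub-++ : ∀ {A : Subset} (F G : FinSub A) → All (λ f → All (f <_) (elems G)) (elems F) → FinSub A
FinSub-++ F G F<G = finSub (elems F ++ elems G) (++-≢[] (nonempty F))
  (AllPairs⇒Linked (AllPairs.++⁺ (Linked⇒AllPairs <-trans (strict F)) (Linked⇒AllPairs <-trans (strict G)) F<G))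
  (++⁺ (inA F) (inA G))

indices : ∀ {x : ℕ → ℕ} {L} → All (Range x) L → Σ (List ℕ) λ J → map x J ≡ L
indices []              = [] , refl
indices ((j , refl) ∷ L⊆X) with indices L⊆X
... | J , refl = j ∷ J , refl

-- Continues the index list J to an infinite sequence; the seed b matters only when J = [].
extend : List ℕ → ℕ → ℕ → ℕ
extend []      b i       = b + i
extend (j ∷ J) b zero    = j
extend (j ∷ J) b (suc i) = extend J (suc j) i

extend-increasing : ∀ J b → Linked _<_ J → StrictlyIncreasing (extend J b)
extend-increasing []           b _          i       = +-monoʳ-< b (n<1+n i)
extend-increasing (j ∷ [])     b _          zero    = m≤m+n (suc j) 0
extend-increasing (j ∷ [])     b _          (suc i) = extend-increasing [] (suc j) [] i
extend-increasing (j ∷ j′ ∷ J) b (j<j′ ∷ _) zero    = j<j′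
extend-increasing (j ∷ j′ ∷ J) b (_ ∷ l)    (suc i) = extend-increasing (j′ ∷ J) (suc j) l i

partialSum-extend : ∀ (f : ℕ → ℕ) J b P {R} → P ++ R ≡ map f J →
                    partialSum (f ∘ extend J b) (length P) ≡ sum P
partialSum-extend f J       b []      _ = refl
partialSum-extend f (j ∷ J) b (p ∷ P) e = begin
  partialSum (f ∘ extend (j ∷ J) b) (suc (length P)) ≡⟨ partialSum-suc (f ∘ extend (j ∷ J) b) (length P) ⟩
  f j + partialSum (f ∘ extend J (suc j)) (length P) ≡⟨ cong₂ _+_ (sym (∷-injectiveˡ e))
                                                          (partialSum-extend f J (suc j) P (∷-injectiveʳ e)) ⟩
  p + sum P                                           ∎
  where open ≡-Reasoning

module _ {x : ℕ → ℕ} (x-inc : StrictlyIncreasing x) where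

  x-mono-≤′ : ∀ {i j} → i ≤′ j → x i ≤ x j
  x-mono-≤′ ≤′-refl        = ≤-refl
  x-mono-≤′ (≤′-step i≤′j) = ≤-trans (x-mono-≤′ i≤′j) (<⇒≤ (x-inc _))

  x-cancel-< : ∀ {i j} → x i < x j → i < j
  x-cancel-< xi<xj = ≰⇒> (λ j≤i → <⇒≱ xi<xj (x-mono-≤′ (≤⇒≤′ j≤i)))

data Blocks (A : Subset) : List ℕ → ℕ → Set where
  []    : Blocks A [] 0
  block : ∀ {P R k} → P ≢ [] → A (sum P) → Blocks A R k → Blocks A (P ++ R) (suc k)

blocks-++ : ∀ {A : Subset} {L k R} → Blocks A L k → R ≢ [] → A (sum R) → Blocks A (L ++ R) (suc k)
blocks-++ {A} {R = R} [] R≢[] R∈A =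
  subst (λ L → Blocks A L 1) (++-identityʳ R) (block R≢[] R∈A [])
blocks-++ {A} {R = R} (block {P} {R′} P≢[] P∈A R′-blocks) R≢[] R∈A =
  subst (λ L → Blocks A L _) (sym (++-assoc P R′ R)) (block P≢[] P∈A (blocks-++ R′-blocks R≢[] R∈A))

module _ {x : ℕ → ℕ} (x-inc : StrictlyIncreasing x) {A : Subset} (A-adequate : Adequate x A) where

  prefix-length-unique : ∀ {L P R P′ R′} → Linked _<_ L → All (Range x) L →
                         P ++ R ≡ L → P′ ++ R′ ≡ L → P ≢ [] → P′ ≢ [] → A (sum P) → A (sum P′) →
                         length P ≡ length P′
  prefix-length-unique {L} {P} {P′ = P′} L-inc L⊆X e e′ P≢[] P′≢[] P∈A P′∈A with indices L⊆X
  ... | J , xJ≡L with proj₂ A-adequate (extend J 0) (extend-increasing J 0 J-inc)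
    where
      J-inc : Linked _<_ J
      J-inc = Linked.map (x-cancel-< x-inc) (map⁻ (subst (Linked _<_) (sym xJ≡L) L-inc))
  ...   | _ , _ , _ , m-unique =
    trans (m-unique (length P) (length-≢[] P≢[]) (prefix∈A P e P∈A))
          (sym (m-unique (length P′) (length-≢[] P′≢[]) (prefix∈A P′ e′ P′∈A)))
    where
      prefix∈A : ∀ Q {S} → Q ++ S ≡ L → A (sum Q) → A (partialSum (x ∘ extend J 0) (length Q))
      prefix∈A Q e Q∈A = subst A (sym (partialSum-extend x J 0 Q (trans e (sym xJ≡L)))) Q∈A

  blocks-unique : ∀ {L L′ k k′} → Linked _<_ L → All (Range x) L →
                  Blocks A L k → Blocks A L′ k′ → L ≡ L′ → k ≡ k′
  blocks-unique _ _ [] [] _ = refl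
  blocks-unique _ _ [] (block P≢[] _ _) e = ⊥-elim (++-≢[] P≢[] (sym e))
  blocks-unique _ _ (block P≢[] _ _) [] e = ⊥-elim (++-≢[] P≢[] e)
  blocks-unique L-inc L⊆X (block {P} {R} P≢[] P∈A R-blocks) (block {P′} {R′} P′≢[] P′∈A R′-blocks) e
    with ++-cancel-length P R P′ R′ e (prefix-length-unique L-inc L⊆X refl (sym e) P≢[] P′≢[] P∈A P′∈A)
  ... | refl , refl = cong suc (blocks-unique (Linked-++⁻ʳ P L-inc) (++⁻ʳ P L⊆X) R-blocks R′-blocks refl)

record IsProperFilter (U : Subset → Set) : Set₁ where
  field
    upward : ∀ {C D} → C ⊆ D → U C → U D
    inter  : ∀ {C D} → U C → U D → U (C ∩ D)
    proper : ∀ {C} → Empty C → ¬ U C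

ultrafilter-isProperFilter : (u : Ultrafilter) → IsProperFilter (mem u)
ultrafilter-isProperFilter u = record
  { upward = Ultrafilter.upward u
  ; inter  = Ultrafilter.inter u
  ; proper = Ultrafilter.noEmpty u _
  }

principal-isProperFilter : ∀ a → IsProperFilter (λ C → C a)
principal-isProperFilter a = record
  { upward = λ C⊆D a∈C → C⊆D a∈C
  ; inter  = _,_
  ; proper = λ C-empty a∈C → C-empty a a∈C
  }

⊕-isProperFilter : ∀ {U V} → IsProperFilter U → IsProperFilter V → IsProperFilter (U ⊕ V)
⊕-isProperFilter U-filter V-filter = record
  { upward = λ C⊆D → U.upward (V.upward C⊆D)
  ; inter  = λ C∈U⊕V D∈U⊕V → U.upward (λ (C∈V , D∈V) → V.inter C∈V D∈V) (U.inter C∈U⊕V D∈U⊕V)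
  ; proper = λ C-empty → U.proper (λ a → V.proper (λ y → C-empty (a + y)))
  }
  where
    module U = IsProperFilter U-filter
    module V = IsProperFilter V-filter

pow-isProperFilter : (u : Ultrafilter) → ∀ n → IsProperFilter (pow u n)
pow-isProperFilter u zero    = principal-isProperFilter 0
pow-isProperFilter u (suc n) = ⊕-isProperFilter (pow-isProperFilter u n) (ultrafilter-isProperFilter u)

BlockSums : (ℕ → ℕ) → Subset → ℕ → Subset
BlockSums x A k z = Σ (FinSub (Range x)) λ F → (sum (elems F) ≡ z) × Blocks A (elems F) k

blockSums-disjoint : ∀ {x A} → StrictlyIncreasing x → UniqueSums (Range x) → Adequate x A →
                     ∀ {k k′ z} → BlockSums x A k z → BlockSums x A k′ z → k ≡ k′
blockSums-disjoint x-inc x-unique A-adequate (F , ΣF≡z , F-blocks) (G , ΣG≡z , G-blocks) =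
  blocks-unique x-inc A-adequate (strict F) (inA F) F-blocks G-blocks (x-unique F G (trans ΣF≡z (sym ΣG≡z)))

⊆blockSums₁ : ∀ {x A} → A ⊆ FS (Range x) → A ⊆ BlockSums x A 1
⊆blockSums₁ {A = A} A⊆FSX z∈A with A⊆FSX z∈A
... | F , ΣF≡z = F , ΣF≡z , blocks-++ [] (nonempty F) (subst A (sym ΣF≡z) z∈A)

module _ {x : ℕ → ℕ} {A : Subset} (u : Ultrafilter) (A∈u : mem u A)
         (tails∈u : ∀ Y → CofiniteIn x Y → mem u (FS Y)) where

  blockSums-shift : ∀ {k a} → BlockSums x A k a → mem u (λ y → BlockSums x A (suc k) (a + y))
  blockSums-shift {k} {a} (F , ΣF≡a , F-blocks) =
    Ultrafilter.upward u append (Ultrafilter.inter u (tails∈u Y Y-cofinite) A∈u)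
    where
      Y : Subset
      Y y = Range x y × a < y
      Y-cofinite : CofiniteIn x Y
      Y-cofinite = proj₁ , suc a , λ i a<xi → (i , refl) , a<xi
      append : FS Y ∩ A ⊆ (λ y → BlockSums x A (suc k) (a + y))
      append ((G , ΣG≡y) , y∈A) =
        FinSub-++ F (FinSub-map proj₁ G) F<G ,
        trans (sum-++ (elems F) (elems G)) (cong₂ _+_ ΣF≡a ΣG≡y) ,
        blocks-++ F-blocks (nonempty G) (subst A (sym ΣG≡y) y∈A)
        where
          F<G : All (λ f → All (f <_) (elems G)) (elems F)
          F<G = All.map (λ f≤a → All.map (λ g∈Y → ≤-<-trans f≤a (proj₂ g∈Y)) (inA G))
                        (subst (λ s → All (_≤ s) (elems F)) ΣF≡a (All-≤-sum (elems F)))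

  blockSums∈pow : A ⊆ FS (Range x) → ∀ {k} → 1 ≤ k → pow u k (BlockSums x A k)
  blockSums∈pow A⊆FSX {1}           _ = Ultrafilter.upward u (⊆blockSums₁ A⊆FSX) A∈u
  blockSums∈pow A⊆FSX {suc (suc k)} _ = IsProperFilter.upward (pow-isProperFilter u (suc k))
    (λ {a} → blockSums-shift {suc k} {a}) (blockSums∈pow A⊆FSX {suc k} (s≤s z≤n))

corollary2p9 : (x : ℕ → ℕ) → StrictlyIncreasing x → UniqueSums (Range x) →
    (u : Ultrafilter) → AdequateUF x u →
    (n m : ℕ) → 1 ≤ n → 1 ≤ m →
    ((pow u n ≈U pow u m → n ≡ m) × (n ≡ m → pow u n ≈U pow u m))
corollary2p9 x x-inc x-unique u ((A , A-adequate , A∈u) , tails∈u) n m n≥1 m≥1 =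
  pow-injective , λ { refl B → id , id }
  where
    open IsProperFilter (pow-isProperFilter u m)
    blockSums∈uᵏ : ∀ {k} → 1 ≤ k → pow u k (BlockSums x A k)
    blockSums∈uᵏ = blockSums∈pow u A∈u tails∈u (proj₁ A-adequate)
    pow-injective : pow u n ≈U pow u m → n ≡ m
    pow-injective uⁿ≈uᵐ = decidable-stable (n ≟ m) λ n≢m →
      proper (λ z (z∈Bₙ , z∈Bₘ) → n≢m (blockSums-disjoint x-inc x-unique A-adequate z∈Bₙ z∈Bₘ))
             (inter (proj₁ (uⁿ≈uᵐ _) (blockSums∈uᵏ n≥1)) (blockSums∈uᵏ m≥1))
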